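{- Let $n\ge3$ and $k\ge3$ be odd integers and $r\ge1$. Let $S_k(G_r^n)$ be the $k$-subdivision of the graph $G_r^n$ defined in the context. Then for every closed Eulerian trail $w$ of $S_k(G_r^n)$, the binomial $B_w$ belongs to the Graver basis of $I_{S_k(G_r^n)}$.
   Context: For a finite simple graph $H$ with vertices $v_1,\dots,v_n$ and edges $e_1,\dots,e_m$, associate to each edge $e=\{v_i,v_j\}$ the vector $\mathbf a_e=\mathbf e_i+\mathbf e_j\in\mathbb Z^n$; the toric ideal $I_H\subseteq\mathbb K[e_1,\dots,e_m]$ is the ideal generated by all binomials $\mathbf e^{\mathbf u}-\mathbf e^{\mathbf v}$ with $\sum u_i\mathbf a_{e_i}=\sum v_i\mathbf a_{e_i}$. Its Graver basis is the set of primitive binomials (irreducible binomials $\mathbf e^{\mathbf u}-\mathbf e^{\mathbf v}\in I_H$ such that no other binomial $\mathbf e^{\mathbf w}-\mathbf e^{\mathbf z}\in I_H$ has $\mathbf e^{\mathbf w}\mid\mathbf e^{\mathbf u}$, $\mathbf e^{\mathbf z}\mid\mathbf e^{\mathbf v}$). For an even closed walk $w=(e_{i_1},\dots,e_{i_{2q}})$, $B_w=\prod_{j=1}^q e_{i_{2j-1}}-\prod_{j=1}^q e_{i_{2j}}$. A closed Eulerian trail is a closed walk using every edge exactly once. Construction: $G_0^n$ is a cycle of length $n$; $G_{r+1}^n$ is obtained from $G_r^n$ by attaching, at each vertex of degree two of $G_r^n$, a new cycle of length $n$ sharing exactly that vertex with the graph built so far (new cycles otherwise pairwise vertex-disjoint).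 The $k$-subdivision $S_k(H)$ replaces every edge $\{u,v\}$ of $H$ by a path of length $k$ from $u$ to $v$ through $k-1$ new vertices. -}

module Defs where

open import Data.Nat using (ℕ; zero; suc; _+_; _*_; _∸_; _≤_; _≡ᵇ_)
open import Data.Bool using (Bool; true; false; if_then_else_; _∨_)
open import Data.List using (List; []; _∷_; [_]; _++_; length; map; foldl; upTo; allFin; lookup; filter; filterᵇ)
open import Data.Nat.ListAction using (sum)
open import Data.List.Relation.Binary.Permutation.Propositional using (_↭_)
open import Data.Fin using (Fin) renaming (_≟_ to _≟ᶠ_)
open import Data.Product using (Σ; ∃; _×_; _,_; proj₁; proj₂)
open import Data.Sum using (_⊎_)
open import Relation.Binary.PropositionalEquality using (_≡_)
open import Relation.Nullary using (¬_)

-- Graphs: vertices are natural numbers, a graph is given by its list of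
-- edges; the edges are e_1,…,e_m, indexed by Fin m (m = length of list).

Edge : Set
Edge = ℕ × ℕ

Graph : Set
Graph = List Edge

-- a graph together with a bound N: vertices used are labelled 0,…,N-1
LGraph : Set
LGraph = ℕ × Graph

deg : Graph → ℕ → ℕ
deg E x = length (filterᵇ (λ e → (proj₁ e ≡ᵇ x) ∨ (proj₂ e ≡ᵇ x)) E)

pathE : List ℕ → Graph
pathE [] = []
pathE (x ∷ []) = []
pathE (x ∷ y ∷ xs) = (x , y) ∷ pathE (y ∷ xs)

cycleE : List ℕ → Graph
cycleE [] = []
cycleE (x ∷ xs) = pathE (x ∷ xs ++ [ x ])

fresh : ℕ → ℕ → List ℕ
fresh N c = map (N +_) (upTo c)

attach : ℕ → LGraph → ℕ → LGraph
attach n (N , E) d = (N + (n ∸ 1) , E ++ cycleE (d ∷ fresh N (n ∸ 1)))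

G : ℕ → ℕ → LGraph
G n zero = (n , cycleE (upTo n))
G n (suc r) =
  foldl (attach n) (G n r)
        (filterᵇ (λ x → deg (proj₂ (G n r)) x ≡ᵇ 2) (upTo (proj₁ (G n r))))

subdivEdge : ℕ → LGraph → Edge → LGraph
subdivEdge k (N , E) (u , v) =
  (N + (k ∸ 1) , E ++ pathE (u ∷ fresh N (k ∸ 1) ++ [ v ]))

S : ℕ → LGraph → LGraph
S k (N , E) = foldl (subdivEdge k) (N , []) E

ind : ℕ → ℕ → ℕ
ind a x = if a ≡ᵇ x then 1 else 0

-- coordinate x of the vector a_e = e_u + e_v
incid : Edge → ℕ → ℕ
incid (a , b) x = ind a x + ind b x

-- coordinate x of Σ_i u_i a_{e_i}
Amul : (E : Graph) → (Fin (length E) → ℕ) → ℕ → ℕ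
Amul E u x = sum (map (λ i → u i * incid (lookup E i) x) (allFin (length E)))

-- a binomial e^u - e^v is represented by its exponent vectors (u , v)
Exps : Graph → Set
Exps E = Fin (length E) → ℕ

-- e^u - e^v is a (nonzero) binomial of I_E
InToric : (E : Graph) → Exps E → Exps E → Set
InToric E u v = ¬ (∀ i → u i ≡ v i) × (∀ x → Amul E u x ≡ Amul E v x)

-- irreducible: gcd(e^u, e^v) = 1
Irreducible : (E : Graph) → Exps E → Exps E → Set
Irreducible E u v = ∀ i → (u i ≡ 0) ⊎ (v i ≡ 0)

-- primitive binomial = element of the Graver basis of I_E
InGraver : (E : Graph) → Exps E → Exps E → Set
InGraver E u v =
  InToric E u v × Irreducible E u v ×
  (∀ (w z : Exps E) → InToric E w z →
     (∀ i → w i ≤ u i) → (∀ i → z i ≤ v i) →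
     ∀ i → (w i ≡ u i) × (z i ≡ v i))

Joins : Edge → ℕ → ℕ → Set
Joins (a , b) x y = ((a ≡ x) × (b ≡ y)) ⊎ ((a ≡ y) × (b ≡ x))

data Walk (E : Graph) : ℕ → ℕ → List (Fin (length E)) → Set where
  nil  : ∀ x → Walk E x x []
  cons : ∀ {x y z i es} → Joins (lookup E i) x y → Walk E y z es →
         Walk E x z (i ∷ es)

ClosedEulerianTrail : (E : Graph) → List (Fin (length E)) → Set
ClosedEulerianTrail E es = (∃ λ x → Walk E x x es) × (es ↭ allFin (length E))

-- odd / even positions (1-indexed) of a sequence
odds : ∀ {A : Set} → List A → List A
evens : ∀ {A : Set} → List A → List A
odds [] = []
odds (x ∷ xs) = x ∷ evens xs
evens [] = []
evens (x ∷ xs) = odds xs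

occ : ∀ {m} → Fin m → List (Fin m) → ℕ
occ i es = length (filter (_≟ᶠ i) es)

-- B_w = ∏ e_{i_{2j-1}} - ∏ e_{i_{2j}} : exponent vectors
Bu : (E : Graph) → List (Fin (length E)) → Exps E
Bu E es i = occ i (odds es)

Bv : (E : Graph) → List (Fin (length E)) → Exps E
Bv E es i = occ i (evens es)

{-# OPTIONS --safe #-}
module Submission where

-- Colour each edge by the parity of its position in the closed Eulerian trail w; then every vertex
-- meets both colours equally often.  A binomial e^w′ - e^z′ of the toric ideal with e^w′ ∣ e^u and
-- e^z′ ∣ e^v selects some edges, again meeting both colours equally often at every vertex, so B_w is
-- primitive as soon as every such selection is empty or everything.  At a vertex of degree two the
-- colours of the two edges differ and the selection takes both or neither; so along a subdivided edge
-- (k odd) the colour at both ends is the same and the selection is constant, and it suffices to argue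
-- in G_r^n.  There the edges of a leaf cycle alternate in colour (n odd), so its two edges at the
-- attachment vertex share a colour; at a vertex of degree four carrying such a cycle, the two edges of
-- the parent cycle then share a colour as well and are selected iff the child cycle is.  Induction
-- from the leaves gives this for every cycle, and the attachment vertices pass the selection on
-- through the whole tree of cycles.

open import Defs
open import Data.Bool using (Bool; true; false; not; _∧_; _∨_; if_then_else_; T)
open import Data.Bool.Properties using (not-involutive)
open import Data.Empty using (⊥-elim)
open import Data.Fin as Fin using (Fin; toℕ; fromℕ<) renaming (_≟_ to _≟ᶠ_)
open import Data.Fin.Properties using (toℕ<n)
open import Data.List
  using (List; []; _∷_; [_]; _++_; length; map; foldl; filterᵇ; upTo; applyUpTo; allFin; lookup; tabulate)
open import Data.List.Properties
  using (map-cong; ++-assoc; ++-identityʳ; length-++; length-tabulate; map-tabulate; map-applyUpTo;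
         filter-++; filter-all; filter-none)
open import Data.List.Relation.Binary.Permutation.Propositional using (_↭_)
open import Data.List.Relation.Binary.Permutation.Propositional.Properties using (↭-length; filter-↭)
open import Data.List.Relation.Unary.All as All using (All; []; _∷_)
open import Data.List.Relation.Unary.All.Properties using (++⁺)
open import Data.Nat
open import Data.Nat.DivMod using (_/_; _%_; m≡m%n+[m/n]*n; m%n<n; m/n≤m; m<n*o⇒m/o<n)
open import Data.Nat.Induction using (<-rec)
open import Data.Nat.ListAction using (sum)
open import Data.Nat.Properties
open import Data.Nat.Tactic.RingSolver using (solve-∀)
open import Data.Product using (Σ; _×_; _,_; proj₁; proj₂)
open import Data.Sum using (_⊎_; inj₁; inj₂)
open import Function using (_∘_; _∘₂_; id; const)
open import Relation.Binary.PropositionalEquality hiding ([_])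
open import Relation.Nullary using (¬_; does; yes; no)
open import Relation.Nullary.Decidable using (T?)
open import Relation.Binary using (tri<; tri≈; tri>)

downward-induction : ∀ (P : ℕ → Set) C →
  (∀ c → c < C → (∀ c′ → c < c′ → c′ < C → P c′) → P c) → ∀ c → c < C → P c
downward-induction P C step c c<C = go C c c<C (m≤m+n C c)
  where
  go : ∀ fuel c → c < C → C ≤ fuel + c → P c
  go zero     c c<C C≤c = ⊥-elim (<⇒≱ c<C C≤c)
  go (suc fuel) c c<C C≤ = step c c<C (λ c′ c<c′ c′<C → go fuel c′ c′<C
    (≤-trans C≤ (≤-trans (≤-reflexive (sym (+-suc fuel c))) (+-monoʳ-≤ fuel c<c′))))

sumBelow : ℕ → (ℕ → ℕ) → ℕ
sumBelow zero    f = 0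
sumBelow (suc l) f = f 0 + sumBelow l (f ∘ suc)

sumBelow-cong : ∀ l {f g} → (∀ i → f i ≡ g i) → sumBelow l f ≡ sumBelow l g
sumBelow-cong zero    f≗g = refl
sumBelow-cong (suc l) f≗g = cong₂ _+_ (f≗g 0) (sumBelow-cong l (f≗g ∘ suc))

sumBelow-+ : ∀ l f g → sumBelow l (λ i → f i + g i) ≡ sumBelow l f + sumBelow l g
sumBelow-+ zero    f g = refl
sumBelow-+ (suc l) f g = begin
  f 0 + g 0 + sumBelow l (λ i → f (suc i) + g (suc i))
    ≡⟨ cong (f 0 + g 0 +_) (sumBelow-+ l (f ∘ suc) (g ∘ suc)) ⟩
  f 0 + g 0 + (sumBelow l (f ∘ suc) + sumBelow l (g ∘ suc))
    ≡⟨ swap-middle (f 0) (g 0) _ _ ⟩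
  f 0 + sumBelow l (f ∘ suc) + (g 0 + sumBelow l (g ∘ suc)) ∎
  where
  open ≡-Reasoning
  swap-middle : ∀ a b c d → a + b + (c + d) ≡ a + c + (b + d)
  swap-middle = solve-∀

sumBelow-zero : ∀ l f → (∀ i → i < l → f i ≡ 0) → sumBelow l f ≡ 0
sumBelow-zero zero    f f≡0 = refl
sumBelow-zero (suc l) f f≡0 =
  cong₂ _+_ (f≡0 0 z<s) (sumBelow-zero l (f ∘ suc) (λ i i<l → f≡0 (suc i) (s<s i<l)))

sumBelow-single : ∀ l f j → j < l → (∀ i → i < l → i ≢ j → f i ≡ 0) → sumBelow l f ≡ f j
sumBelow-single (suc l) f zero    _         f≡0 = begin
  f 0 + sumBelow l (f ∘ suc)
    ≡⟨ cong (f 0 +_) (sumBelow-zero l (f ∘ suc) (λ i i<l → f≡0 (suc i) (s<s i<l) (λ ()))) ⟩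
  f 0 + 0
    ≡⟨ +-identityʳ (f 0) ⟩
  f 0 ∎
  where open ≡-Reasoning
sumBelow-single (suc l) f (suc j) (s<s j<l) f≡0 = cong₂ _+_ (f≡0 0 z<s (λ ()))
  (sumBelow-single l (f ∘ suc) j j<l (λ i i<l i≢j → f≡0 (suc i) (s<s i<l) (i≢j ∘ suc-injective)))

ind-refl : ∀ a → ind a a ≡ 1
ind-refl zero    = refl
ind-refl (suc a) = ind-refl a

ind-≢ : ∀ {a x} → a ≢ x → ind a x ≡ 0
ind-≢ {zero}  {zero}  a≢x = ⊥-elim (a≢x refl)
ind-≢ {zero}  {suc x} a≢x = refl
ind-≢ {suc a} {zero}  a≢x = refl
ind-≢ {suc a} {suc x} a≢x = ind-≢ (a≢x ∘ cong suc)

ind-< : ∀ {a x} → a < x → ind a x ≡ 0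
ind-< a<x = ind-≢ (<⇒≢ a<x)

-- Incidence vectors

-- Amul with the exponent vector indexed by ℕ instead of Fin (length E).
Aℕ : Graph → (ℕ → ℕ) → ℕ → ℕ
Aℕ []      g x = 0
Aℕ (e ∷ E) g x = g 0 * incid e x + Aℕ E (g ∘ suc) x

Aℕ-cong : ∀ E {g h} x → (∀ j → g j ≡ h j) → Aℕ E g x ≡ Aℕ E h x
Aℕ-cong []      x g≗h = refl
Aℕ-cong (e ∷ E) x g≗h = cong₂ _+_ (cong (_* incid e x) (g≗h 0)) (Aℕ-cong E x (g≗h ∘ suc))

Aℕ-++ : ∀ E E′ g x → Aℕ (E ++ E′) g x ≡ Aℕ E g x + Aℕ E′ (g ∘ (length E +_)) x
Aℕ-++ []      E′ g x = refl
Aℕ-++ (e ∷ E) E′ g x =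
  trans (cong (g 0 * incid e x +_) (Aℕ-++ E E′ (g ∘ suc) x)) (sym (+-assoc (g 0 * incid e x) _ _))

Bounded : ℕ → Graph → Set
Bounded N E = All (λ e → proj₁ e < N × proj₂ e < N) E

Aℕ-beyond : ∀ {N E} g x → Bounded N E → N ≤ x → Aℕ E g x ≡ 0
Aℕ-beyond g x [] N≤x = refl
Aℕ-beyond {E = (a , b) ∷ E} g x ((a<N , b<N) ∷ bounded) N≤x = begin
  g 0 * (ind a x + ind b x) + Aℕ E (g ∘ suc) x
    ≡⟨ cong₂ (λ p q → g 0 * (p + q) + Aℕ E (g ∘ suc) x)
             (ind-< (<-≤-trans a<N N≤x)) (ind-< (<-≤-trans b<N N≤x)) ⟩
  g 0 * 0 + Aℕ E (g ∘ suc) x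
    ≡⟨ cong₂ _+_ (*-zeroʳ (g 0)) (Aℕ-beyond (g ∘ suc) x bounded N≤x) ⟩
  0 ∎
  where open ≡-Reasoning

record Meets (E : Graph) (x : ℕ) (js : List ℕ) : Set where
  constructor meets
  field Aℕ≡sum : ∀ g → Aℕ E g x ≡ sum (map g js)
open Meets

-- Balanced selections of edges

⟦_⟧ : Bool → ℕ
⟦ b ⟧ = if b then 1 else 0

mark : (ℕ → Bool) → (ℕ → Bool) → ℕ → ℕ
mark U F j = ⟦ U j ∧ F j ⟧

-- U colours the edges and F selects some of them; the selection is balanced if at every vertex
-- it meets both colours equally often.  For B_w the colour of an edge is the parity of its
-- position in w, and a binomial e^w′ - e^z′ of I_E with e^w′ ∣ e^u and e^z′ ∣ e^v is a
-- balanced selection (w′ on one colour, z′ on the other).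
Balanced : Graph → (ℕ → Bool) → (ℕ → Bool) → Set
Balanced E U F = ∀ x → Aℕ E (mark U F) x ≡ Aℕ E (mark (not ∘ U) F) x

Rigid : Graph → Set
Rigid E = ∀ U F → Balanced E U (const true) → Balanced E U F → ∀ j → j < length E → F j ≡ F 0

balanced-at : ∀ {E x js} U F → Balanced E U F → Meets E x js →
  sum (map (mark U F) js) ≡ sum (map (mark (not ∘ U) F) js)
balanced-at {x = x} U F balanced meets-x =
  trans (sym (Aℕ≡sum meets-x (mark U F))) (trans (balanced x) (Aℕ≡sum meets-x (mark (not ∘ U) F)))

balanced-bits₂ : ∀ ua ub fa fb →
  ⟦ ua ∧ true ⟧ + (⟦ ub ∧ true ⟧ + 0) ≡ ⟦ not ua ∧ true ⟧ + (⟦ not ub ∧ true ⟧ + 0) →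
  ⟦ ua ∧ fa ⟧ + (⟦ ub ∧ fb ⟧ + 0) ≡ ⟦ not ua ∧ fa ⟧ + (⟦ not ub ∧ fb ⟧ + 0) →
  ub ≡ not ua × fa ≡ fb
balanced-bits₂ true  true  _     _     () _
balanced-bits₂ false false _     _     () _
balanced-bits₂ true  false false false _  _  = refl , refl
balanced-bits₂ true  false true  true  _  _  = refl , refl
balanced-bits₂ true  false false true  _  ()
balanced-bits₂ true  false true  false _  ()
balanced-bits₂ false true  false false _  _  = refl , refl
balanced-bits₂ false true  true  true  _  _  = refl , refl
balanced-bits₂ false true  false true  _  ()
balanced-bits₂ false true  true  false _  ()

bits-sum-double : ∀ a b p → ⟦ a ⟧ + (⟦ b ⟧ + 0) ≡ ⟦ p ⟧ + (⟦ p ⟧ + 0) → a ≡ p × b ≡ p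
bits-sum-double false false false _  = refl , refl
bits-sum-double true  true  true  _  = refl , refl
bits-sum-double false false true  ()
bits-sum-double false true  false ()
bits-sum-double false true  true  ()
bits-sum-double true  false false ()
bits-sum-double true  false true  ()
bits-sum-double true  true  false ()

balanced-bits₄ : ∀ ua ub uc ud fa fb fc fd → uc ≡ ud → fc ≡ fd →
  ⟦ ua ∧ true ⟧ + (⟦ ub ∧ true ⟧ + (⟦ uc ∧ true ⟧ + (⟦ ud ∧ true ⟧ + 0))) ≡
  ⟦ not ua ∧ true ⟧ + (⟦ not ub ∧ true ⟧ + (⟦ not uc ∧ true ⟧ + (⟦ not ud ∧ true ⟧ + 0))) →
  ⟦ ua ∧ fa ⟧ + (⟦ ub ∧ fb ⟧ + (⟦ uc ∧ fc ⟧ + (⟦ ud ∧ fd ⟧ + 0))) ≡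
  ⟦ not ua ∧ fa ⟧ + (⟦ not ub ∧ fb ⟧ + (⟦ not uc ∧ fc ⟧ + (⟦ not ud ∧ fd ⟧ + 0))) →
  ua ≡ ub × fa ≡ fc × fb ≡ fc
balanced-bits₄ true  true  false _ fa fb fc _ refl refl _ eF = refl , bits-sum-double fa fb fc eF
balanced-bits₄ false false true  _ fa fb fc _ refl refl _ eF = refl , bits-sum-double fa fb fc (sym eF)
balanced-bits₄ true  true  true  _ _  _  _  _ refl refl () _
balanced-bits₄ true  false true  _ _  _  _  _ refl refl () _
balanced-bits₄ true  false false _ _  _  _  _ refl refl () _
balanced-bits₄ false true  true  _ _  _  _  _ refl refl () _
balanced-bits₄ false true  false _ _  _  _  _ refl refl () _
balanced-bits₄ false false false _ _  _  _  _ refl refl () _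

module _ {E U F} (balancedU : Balanced E U (const true)) (balancedF : Balanced E U F) where

  balanced-degree-two : ∀ {x a b} → Meets E x (a ∷ b ∷ []) → U b ≡ not (U a) × F a ≡ F b
  balanced-degree-two {a = a} {b} meets-x =
    balanced-bits₂ (U a) (U b) (F a) (F b)
      (balanced-at U (const true) balancedU meets-x) (balanced-at U F balancedF meets-x)

  balanced-degree-four : ∀ {x a b c d} → Meets E x (a ∷ b ∷ c ∷ d ∷ []) →
    U c ≡ U d → F c ≡ F d → U a ≡ U b × F a ≡ F c × F b ≡ F c
  balanced-degree-four {a = a} {b} {c} {d} meets-x Uc≡Ud Fc≡Fd =
    balanced-bits₄ (U a) (U b) (U c) (U d) (F a) (F b) (F c) (F d) Uc≡Ud Fc≡Fd
      (balanced-at U (const true) balancedU meets-x) (balanced-at U F balancedF meets-x)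

constant-chain : ∀ {A : Set} (f : ℕ → A) b l → (∀ i → i < l → f (b + i) ≡ f (b + suc i)) →
  ∀ i → i ≤ l → f (b + i) ≡ f b
constant-chain f b l step zero    _     = cong f (+-identityʳ b)
constant-chain f b l step (suc i) 1+i≤l =
  trans (sym (step i 1+i≤l)) (constant-chain f b l step i (<⇒≤ 1+i≤l))

alternating-chain : ∀ (f : ℕ → Bool) b l → (∀ i → i < l → f (b + suc i) ≡ not (f (b + i))) →
  ∀ q → l ≡ q * 2 → f (b + l) ≡ f b
alternating-chain f b l step q refl = even-steps q ≤-refl
  where
  even-steps : ∀ q′ → q′ * 2 ≤ l → f (b + q′ * 2) ≡ f b
  even-steps zero     _   = cong f (+-identityʳ b)
  even-steps (suc q′) q≤l = begin
    f (b + suc (suc (q′ * 2)))   ≡⟨ step (suc (q′ * 2)) q≤l ⟩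
    not (f (b + suc (q′ * 2)))   ≡⟨ cong not (step (q′ * 2) (<⇒≤ q≤l)) ⟩
    not (not (f (b + q′ * 2)))   ≡⟨ not-involutive _ ⟩
    f (b + q′ * 2)               ≡⟨ even-steps q′ (≤-trans (n≤1+n _) (<⇒≤ q≤l)) ⟩
    f b ∎
    where open ≡-Reasoning

-- Graver elements from closed Eulerian trails

incidence : (E : Graph) → ℕ → Fin (length E) → ℕ
incidence E x j = incid (lookup E j) x

Amul-∷ : ∀ e E u x → Amul (e ∷ E) u x ≡ u Fin.zero * incid e x + Amul E (u ∘ Fin.suc) x
Amul-∷ e E u x = cong (u Fin.zero * incid e x +_)
  (cong sum (trans (map-tabulate Fin.suc term) (sym (map-tabulate id (term ∘ Fin.suc)))))
  where
  term : Fin (length (e ∷ E)) → ℕ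
  term i = u i * incidence (e ∷ E) x i

Amul-cong : ∀ E {u v} x → (∀ i → u i ≡ v i) → Amul E u x ≡ Amul E v x
Amul-cong E x u≗v =
  cong sum (map-cong (λ i → cong (_* incidence E x i) (u≗v i)) (allFin (length E)))

Aℕ≡Amul : ∀ E g x → Aℕ E g x ≡ Amul E (g ∘ toℕ) x
Aℕ≡Amul []      g x = refl
Aℕ≡Amul (e ∷ E) g x =
  trans (cong (g 0 * incid e x +_) (Aℕ≡Amul E (g ∘ suc) x)) (sym (Amul-∷ e E (g ∘ toℕ) x))

Amul-zero : ∀ E x → Amul E (λ _ → 0) x ≡ 0
Amul-zero []      x = refl
Amul-zero (e ∷ E) x = trans (Amul-∷ e E (λ _ → 0) x) (Amul-zero E x)

Amul-+ : ∀ E u v x → Amul E (λ i → u i + v i) x ≡ Amul E u x + Amul E v x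
Amul-+ []      u v x = refl
Amul-+ (e ∷ E) u v x = begin
  Amul (e ∷ E) (λ i → u i + v i) x
    ≡⟨ Amul-∷ e E (λ i → u i + v i) x ⟩
  (u₀ + v₀) * incid e x + Amul E (λ i → u (Fin.suc i) + v (Fin.suc i)) x
    ≡⟨ cong ((u₀ + v₀) * incid e x +_) (Amul-+ E (u ∘ Fin.suc) (v ∘ Fin.suc) x) ⟩
  (u₀ + v₀) * incid e x + (Amul E (u ∘ Fin.suc) x + Amul E (v ∘ Fin.suc) x)
    ≡⟨ distribute u₀ v₀ (incid e x) _ _ ⟩
  (u₀ * incid e x + Amul E (u ∘ Fin.suc) x) + (v₀ * incid e x + Amul E (v ∘ Fin.suc) x)
    ≡⟨ sym (cong₂ _+_ (Amul-∷ e E u x) (Amul-∷ e E v x)) ⟩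
  Amul (e ∷ E) u x + Amul (e ∷ E) v x ∎
  where
  open ≡-Reasoning
  u₀ : ℕ
  u₀ = u Fin.zero
  v₀ : ℕ
  v₀ = v Fin.zero
  distribute : ∀ a b c s t → (a + b) * c + (s + t) ≡ (a * c + s) + (b * c + t)
  distribute = solve-∀

Amul-unit : ∀ E j x → Amul E (λ i → ⟦ does (j ≟ᶠ i) ⟧) x ≡ incidence E x j
Amul-unit (e ∷ E) Fin.zero    x =
  trans (Amul-∷ e E (λ i → ⟦ does (Fin.zero ≟ᶠ i) ⟧) x)
    (trans (cong (incid e x + 0 +_) (Amul-zero E x)) (trans (+-identityʳ _) (+-identityʳ _)))
Amul-unit (e ∷ E) (Fin.suc j) x =
  trans (Amul-∷ e E (λ i → ⟦ does (Fin.suc j ≟ᶠ i) ⟧) x) (Amul-unit E j x)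

occ-∷ : ∀ {m} (i j : Fin m) js → occ i (j ∷ js) ≡ ⟦ does (j ≟ᶠ i) ⟧ + occ i js
occ-∷ i j js with j ≟ᶠ i
... | yes _ = refl
... | no  _ = refl

Amul-occ : ∀ E js x → Amul E (λ i → occ i js) x ≡ sum (map (incidence E x) js)
Amul-occ E []       x = Amul-zero E x
Amul-occ E (j ∷ js) x = begin
  Amul E (λ i → occ i (j ∷ js)) x
    ≡⟨ Amul-cong E x (λ i → occ-∷ i j js) ⟩
  Amul E (λ i → ⟦ does (j ≟ᶠ i) ⟧ + occ i js) x
    ≡⟨ Amul-+ E (λ i → ⟦ does (j ≟ᶠ i) ⟧) (λ i → occ i js) x ⟩
  Amul E (λ i → ⟦ does (j ≟ᶠ i) ⟧) x + Amul E (λ i → occ i js) x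
    ≡⟨ cong₂ _+_ (Amul-unit E j x) (Amul-occ E js x) ⟩
  incidence E x j + sum (map (incidence E x) js) ∎
  where open ≡-Reasoning

occ-odds+evens : ∀ {m} (i : Fin m) es → occ i (odds es) + occ i (evens es) ≡ occ i es
occ-odds+evens i []       = refl
occ-odds+evens i (j ∷ es) = begin
  occ i (j ∷ evens es) + occ i (odds es)
    ≡⟨ cong (_+ occ i (odds es)) (occ-∷ i j (evens es)) ⟩
  ⟦ does (j ≟ᶠ i) ⟧ + occ i (evens es) + occ i (odds es)
    ≡⟨ +-assoc ⟦ does (j ≟ᶠ i) ⟧ _ _ ⟩
  ⟦ does (j ≟ᶠ i) ⟧ + (occ i (evens es) + occ i (odds es))
    ≡⟨ cong (⟦ does (j ≟ᶠ i) ⟧ +_) (trans (+-comm (occ i (evens es)) _) (occ-odds+evens i es)) ⟩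
  ⟦ does (j ≟ᶠ i) ⟧ + occ i es
    ≡⟨ sym (occ-∷ i j es) ⟩
  occ i (j ∷ es) ∎
  where open ≡-Reasoning

occ-allFin : ∀ m (i : Fin m) → occ i (allFin m) ≡ 1
occ-allFin (suc m) Fin.zero    = cong suc (occ-zero-suc id)
  where
  occ-zero-suc : ∀ {k} (f : Fin k → Fin m) → occ Fin.zero (tabulate (Fin.suc ∘ f)) ≡ 0
  occ-zero-suc {zero}  f = refl
  occ-zero-suc {suc k} f = occ-zero-suc (f ∘ Fin.suc)
occ-allFin (suc m) (Fin.suc i) = trans (occ-suc-suc id) (occ-allFin m i)
  where
  occ-suc-suc : ∀ {k} (f : Fin k → Fin m) →
    occ (Fin.suc i) (tabulate (Fin.suc ∘ f)) ≡ occ i (tabulate f)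
  occ-suc-suc {zero}  f = refl
  occ-suc-suc {suc k} f = begin
    occ (Fin.suc i) (Fin.suc (f Fin.zero) ∷ tabulate (Fin.suc ∘ f ∘ Fin.suc))
      ≡⟨ occ-∷ (Fin.suc i) (Fin.suc (f Fin.zero)) _ ⟩
    ⟦ does (f Fin.zero ≟ᶠ i) ⟧ + occ (Fin.suc i) (tabulate (Fin.suc ∘ f ∘ Fin.suc))
      ≡⟨ cong (⟦ does (f Fin.zero ≟ᶠ i) ⟧ +_) (occ-suc-suc (f ∘ Fin.suc)) ⟩
    ⟦ does (f Fin.zero ≟ᶠ i) ⟧ + occ i (tabulate (f ∘ Fin.suc))
      ≡⟨ sym (occ-∷ i (f Fin.zero) _) ⟩
    occ i (tabulate f) ∎
    where open ≡-Reasoning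

occ-↭ : ∀ {m} (i : Fin m) {xs ys} → xs ↭ ys → occ i xs ≡ occ i ys
occ-↭ i xs↭ys = ↭-length (filter-↭ (_≟ᶠ i) xs↭ys)

Joins⇒incid : ∀ {e y y′} x → Joins e y y′ → incid e x ≡ ind y x + ind y′ x
Joins⇒incid {a , b} x (inj₁ (refl , refl)) = refl
Joins⇒incid {a , b} x (inj₂ (refl , refl)) = +-comm (ind a x) (ind b x)

-- Each pair of consecutive edges y – y′ – y″ contributes ind y + ind y′ to the odd side and
-- ind y′ + ind y″ to the even side, so the difference telescopes.
walk-balance : ∀ {E y z es} → Walk E y z es → ∀ q → length es ≡ q * 2 → ∀ x →
  sum (map (incidence E x) (odds es)) + ind z x ≡ sum (map (incidence E x) (evens es)) + ind y x
walk-balance (nil y)                   zero    _   x = refl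
walk-balance (cons _ (nil _))          zero    ()
walk-balance (cons _ (nil _))          (suc q) ()
walk-balance {E} {y} {z} (cons {y = y′} {i = i} y-y′ (cons {y = y″} {i = i′} {es} y′-y″ walk))
             (suc q) len x = begin
  incidence E x i + O + ind z x
    ≡⟨ cong (λ s → s + O + ind z x) (Joins⇒incid x y-y′) ⟩
  ind y x + ind y′ x + O + ind z x
    ≡⟨ +-assoc (ind y x + ind y′ x) O (ind z x) ⟩
  ind y x + ind y′ x + (O + ind z x)
    ≡⟨ cong (ind y x + ind y′ x +_) (walk-balance walk q (suc-injective (suc-injective len)) x) ⟩
  ind y x + ind y′ x + (V + ind y″ x)
    ≡⟨ shuffle (ind y x) (ind y′ x) (ind y″ x) V ⟩
  ind y′ x + ind y″ x + V + ind y x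
    ≡⟨ cong (λ s → s + V + ind y x) (sym (Joins⇒incid x y′-y″)) ⟩
  incidence E x i′ + V + ind y x ∎
  where
  open ≡-Reasoning
  O : ℕ
  O = sum (map (incidence E x) (odds es))
  V : ℕ
  V = sum (map (incidence E x) (evens es))
  shuffle : ∀ a b c s → a + b + (s + c) ≡ b + c + s + a
  shuffle = solve-∀

extend : ∀ {m} {A : Set} → A → (Fin m → A) → ℕ → A
extend {zero}  d f j       = d
extend {suc m} d f zero    = f Fin.zero
extend {suc m} d f (suc j) = extend d (f ∘ Fin.suc) j

extend-toℕ : ∀ {m} {A : Set} (d : A) (f : Fin m → A) i → extend d f (toℕ i) ≡ f i
extend-toℕ d f Fin.zero    = refl
extend-toℕ d f (Fin.suc i) = extend-toℕ d (f ∘ Fin.suc) i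

Balanced-from-Amul : ∀ E (U S : ℕ → Bool) (a b : Exps E) →
  (∀ i → mark U S (toℕ i) ≡ a i) → (∀ i → mark (not ∘ U) S (toℕ i) ≡ b i) →
  (∀ x → Amul E a x ≡ Amul E b x) → Balanced E U S
Balanced-from-Amul E U S a b a≗ b≗ Aa≡Ab x = begin
  Aℕ E (mark U S) x               ≡⟨ Aℕ≡Amul E (mark U S) x ⟩
  Amul E (mark U S ∘ toℕ) x       ≡⟨ Amul-cong E x a≗ ⟩
  Amul E a x                      ≡⟨ Aa≡Ab x ⟩
  Amul E b x                      ≡⟨ sym (Amul-cong E x b≗) ⟩
  Amul E (mark (not ∘ U) S ∘ toℕ) x ≡⟨ sym (Aℕ≡Amul E (mark (not ∘ U) S) x) ⟩
  Aℕ E (mark (not ∘ U) S) x ∎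
  where open ≡-Reasoning

bit : ℕ → Bool
bit a = a ≡ᵇ 1

colour-bits : ∀ {u v} → u + v ≡ 1 → ⟦ bit u ∧ true ⟧ ≡ u × ⟦ not (bit u) ∧ true ⟧ ≡ v
colour-bits {0}           refl = refl , refl
colour-bits {1}           refl = refl , refl
colour-bits {suc (suc _)} ()

selection-bits : ∀ {u v w z} → u + v ≡ 1 → w ≤ u → z ≤ v →
  ⟦ bit u ∧ bit (w + z) ⟧ ≡ w × ⟦ not (bit u) ∧ bit (w + z) ⟧ ≡ z
selection-bits {0}           refl z≤n       z≤n       = refl , refl
selection-bits {0}           refl z≤n       (s≤s z≤n) = refl , refl
selection-bits {1}           refl z≤n       z≤n       = refl , refl
selection-bits {1}           refl (s≤s z≤n) z≤n       = refl , refl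
selection-bits {suc (suc _)} ()

selection-empty : ∀ {u v w z} → u + v ≡ 1 → w ≤ u → z ≤ v → bit (w + z) ≡ false → w ≡ z
selection-empty {0}           refl z≤n       z≤n       _  = refl
selection-empty {0}           refl z≤n       (s≤s z≤n) ()
selection-empty {1}           refl z≤n       z≤n       _  = refl
selection-empty {1}           refl (s≤s z≤n) z≤n       ()
selection-empty {suc (suc _)} ()

selection-full : ∀ {u v w z} → u + v ≡ 1 → w ≤ u → z ≤ v → bit (w + z) ≡ true → w ≡ u × z ≡ v
selection-full {0}           refl z≤n       z≤n       ()
selection-full {0}           refl z≤n       (s≤s z≤n) _  = refl , refl
selection-full {1}           refl z≤n       z≤n       ()
selection-full {1}           refl (s≤s z≤n) z≤n       _  = refl , refl
selection-full {suc (suc _)} ()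

n+n≢1 : ∀ a → a + a ≢ 1
n+n≢1 (suc a) a+a≡1 = 1+n≢0 (m+n≡0⇒n≡0 a (suc-injective a+a≡1))

module _ (E : Graph) (rigid : Rigid E) {u v : Exps E}
  (partition : ∀ i → u i + v i ≡ 1) (balanced : ∀ x → Amul E u x ≡ Amul E v x) where

  partition-minimal : ∀ w z → InToric E w z → (∀ i → w i ≤ u i) → (∀ i → z i ≤ v i) →
    ∀ i → w i ≡ u i × z i ≡ v i
  partition-minimal w z (w≢z , Aw≡Az) w≤u z≤v =
    from-selection (F 0) (λ i → trans (sym (F-at i)) (F-constant i))
    where
    U F : ℕ → Bool
    U = extend false (λ i → bit (u i))
    F = extend false (λ i → bit (w i + z i))
    U-at : ∀ i → U (toℕ i) ≡ bit (u i)
    U-at = extend-toℕ false (λ i → bit (u i))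
    F-at : ∀ i → F (toℕ i) ≡ bit (w i + z i)
    F-at = extend-toℕ false (λ i → bit (w i + z i))
    balancedU : Balanced E U (const true)
    balancedU = Balanced-from-Amul E U (const true) u v
      (λ i → trans (cong (λ c → ⟦ c ∧ true ⟧) (U-at i)) (proj₁ (colour-bits (partition i))))
      (λ i → trans (cong (λ c → ⟦ not c ∧ true ⟧) (U-at i)) (proj₂ (colour-bits (partition i))))
      balanced
    balancedF : Balanced E U F
    balancedF = Balanced-from-Amul E U F w z
      (λ i → trans (cong₂ (λ c s → ⟦ c ∧ s ⟧) (U-at i) (F-at i))
                   (proj₁ (selection-bits (partition i) (w≤u i) (z≤v i))))
      (λ i → trans (cong₂ (λ c s → ⟦ not c ∧ s ⟧) (U-at i) (F-at i))
                   (proj₂ (selection-bits (partition i) (w≤u i) (z≤v i))))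
      Aw≡Az
    F-constant : ∀ i → F (toℕ i) ≡ F 0
    F-constant i = rigid U F balancedU balancedF (toℕ i) (toℕ<n i)
    from-selection : ∀ s → (∀ i → bit (w i + z i) ≡ s) → ∀ i → w i ≡ u i × z i ≡ v i
    from-selection false none = ⊥-elim (w≢z (λ i → selection-empty (partition i) (w≤u i) (z≤v i) (none i)))
    from-selection true  all  = λ i → selection-full (partition i) (w≤u i) (z≤v i) (all i)

  partition-graver : 0 < length E → InGraver E u v
  partition-graver 0<m = (u≢v , balanced) , irreducible , partition-minimal
    where
    u≢v : ¬ (∀ i → u i ≡ v i)
    u≢v u≗v = n+n≢1 (u i₀) (trans (cong (u i₀ +_) (u≗v i₀)) (partition i₀))
      where
      i₀ : Fin (length E)
      i₀ = fromℕ< 0<m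
    irreducible : Irreducible E u v
    irreducible i with u i | partition i
    ... | zero     | _     = inj₁ refl
    ... | suc zero | 1+v≡1 = inj₂ (suc-injective 1+v≡1)

eulerian-trail-graver : ∀ E es q .{{_ : NonZero q}} → length E ≡ q * 2 → Rigid E →
  ClosedEulerianTrail E es → InGraver E (Bu E es) (Bv E es)
eulerian-trail-graver E es q length-even rigid ((x₀ , walk) , es↭) =
  partition-graver E rigid partition balanced (subst (0 <_) (sym length-even) (m<n⇒m<n*o 2 (>-nonZero⁻¹ q)))
  where
  open ≡-Reasoning
  partition : ∀ i → Bu E es i + Bv E es i ≡ 1
  partition i = trans (occ-odds+evens i es) (trans (occ-↭ i es↭) (occ-allFin (length E) i))
  length-es : length es ≡ q * 2
  length-es = trans (↭-length es↭) (trans (length-tabulate id) length-even)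
  balanced : ∀ x → Amul E (Bu E es) x ≡ Amul E (Bv E es) x
  balanced x = begin
    Amul E (Bu E es) x
      ≡⟨ Amul-occ E (odds es) x ⟩
    sum (map (incidence E x) (odds es))
      ≡⟨ +-cancelʳ-≡ (ind x₀ x) _ _ (walk-balance walk q length-es x) ⟩
    sum (map (incidence E x) (evens es))
      ≡⟨ sym (Amul-occ E (evens es) x) ⟩
    Amul E (Bv E es) x ∎

-- Paths through fresh vertices and subdivisions

range : ℕ → ℕ → List ℕ
range F zero    = []
range F (suc L) = F ∷ range (suc F) L

applyUpTo≡range : ∀ L {h} F → (∀ i → h i ≡ F + i) → applyUpTo h L ≡ range F L
applyUpTo≡range zero    F h≗ = refl
applyUpTo≡range (suc L) F h≗ =
  cong₂ _∷_ (trans (h≗ 0) (+-identityʳ F))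
            (applyUpTo≡range L (suc F) (λ i → trans (h≗ (suc i)) (+-suc F i)))

fresh≡range : ∀ F L → fresh F L ≡ range F L
fresh≡range F L = trans (map-applyUpTo id (F +_) L) (applyUpTo≡range L F (λ i → refl))

range-++ : ∀ F l l′ → range F (l + l′) ≡ range F l ++ range (F + l) l′
range-++ F zero    l′ = cong (λ F′ → range F′ l′) (sym (+-identityʳ F))
range-++ F (suc l) l′ = cong (F ∷_) (trans (range-++ (suc F) l l′)
  (cong (λ F′ → range (suc F) l ++ range F′ l′) (sym (+-suc F l))))

All-range : ∀ {P : ℕ → Set} F l → (∀ i → i < l → P (F + i)) → All P (range F l)
All-range {P} F zero    p = []
All-range {P} F (suc l) p =
  subst P (+-identityʳ F) (p 0 z<s) ∷ All-range (suc F) l (λ i i<l → subst P (+-suc F i) (p (suc i) (s<s i<l)))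

freshPath : ℕ → ℕ → ℕ → ℕ → Graph
freshPath y F L b = pathE (y ∷ range F L ++ [ b ])

length-freshPath : ∀ y F L b → length (freshPath y F L b) ≡ suc L
length-freshPath y F zero    b = refl
length-freshPath y F (suc L) b = cong suc (length-freshPath F (suc F) L b)

Aℕ-freshPath : ∀ y F L b g x → Aℕ (freshPath y F L b) g x ≡
  ind y x * g 0 + ind b x * g L + sumBelow L (λ i → ind (F + i) x * (g i + g (suc i)))
Aℕ-freshPath y F zero b g x = rearrange (g 0) (ind y x) (ind b x)
  where
  rearrange : ∀ a p q → a * (p + q) + 0 ≡ p * a + q * a + 0
  rearrange = solve-∀
Aℕ-freshPath y F (suc L) b g x = begin
  g 0 * (ind y x + ind F x) + Aℕ (freshPath F (suc F) L b) (g ∘ suc) x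
    ≡⟨ cong (g 0 * (ind y x + ind F x) +_) (Aℕ-freshPath F (suc F) L b (g ∘ suc) x) ⟩
  g 0 * (ind y x + ind F x) + (ind F x * g 1 + ind b x * g (suc L) + rest)
    ≡⟨ rearrange (g 0) (g 1) (ind y x) (ind F x) (ind b x) (g (suc L)) rest ⟩
  ind y x * g 0 + ind b x * g (suc L) + (ind F x * (g 0 + g 1) + rest)
    ≡⟨ cong₂ (λ F′ s → ind y x * g 0 + ind b x * g (suc L) + (ind F′ x * (g 0 + g 1) + s))
             (sym (+-identityʳ F))
             (sumBelow-cong L (λ i → cong (λ v → ind v x * (g (suc i) + g (2 + i))) (sym (+-suc F i)))) ⟩
  ind y x * g 0 + ind b x * g (suc L) + sumBelow (suc L) (λ i → ind (F + i) x * (g i + g (suc i))) ∎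
  where
  open ≡-Reasoning
  rest : ℕ
  rest = sumBelow L (λ i → ind (suc F + i) x * (g (suc i) + g (2 + i)))
  rearrange : ∀ a a′ p q r c s →
    a * (p + q) + (q * a′ + r * c + s) ≡ p * a + r * c + (q * (a + a′) + s)
  rearrange = solve-∀

sumBelow-ind-outside : ∀ L F x (h : ℕ → ℕ) → x < F ⊎ F + L ≤ x →
  sumBelow L (λ i → ind (F + i) x * h i) ≡ 0
sumBelow-ind-outside L F x h outside =
  sumBelow-zero L (λ i → ind (F + i) x * h i) (λ i i<L → cong (_* h i) (ind-≢ (F+i≢x i i<L outside)))
  where
  F+i≢x : ∀ i → i < L → x < F ⊎ F + L ≤ x → F + i ≢ x
  F+i≢x i i<L (inj₁ x<F)   refl = <⇒≱ x<F (m≤m+n F i)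
  F+i≢x i i<L (inj₂ F+L≤x) refl = <⇒≱ (+-monoʳ-< F i<L) F+L≤x

sumBelow-ind-inside : ∀ L F i (h : ℕ → ℕ) → i < L →
  sumBelow L (λ j → ind (F + j) (F + i) * h j) ≡ h i
sumBelow-ind-inside L F i h i<L = begin
  sumBelow L (λ j → ind (F + j) (F + i) * h j)
    ≡⟨ sumBelow-single L (λ j → ind (F + j) (F + i) * h j) i i<L
         (λ j _ j≢i → cong (_* h j) (ind-≢ (j≢i ∘ +-cancelˡ-≡ F j i))) ⟩
  ind (F + i) (F + i) * h i
    ≡⟨ cong (_* h i) (ind-refl (F + i)) ⟩
  h i + 0
    ≡⟨ +-identityʳ (h i) ⟩
  h i ∎
  where open ≡-Reasoning

Aℕ-freshPath-inside : ∀ y F L b g i → y < F → b < F → i < L →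
  Aℕ (freshPath y F L b) g (F + i) ≡ g i + g (suc i)
Aℕ-freshPath-inside y F L b g i y<F b<F i<L = begin
  Aℕ (freshPath y F L b) g (F + i)
    ≡⟨ Aℕ-freshPath y F L b g (F + i) ⟩
  ind y (F + i) * g 0 + ind b (F + i) * g L + inner
    ≡⟨ cong₂ (λ p q → p * g 0 + q * g L + inner)
             (ind-< (<-≤-trans y<F (m≤m+n F i))) (ind-< (<-≤-trans b<F (m≤m+n F i))) ⟩
  inner
    ≡⟨ sumBelow-ind-inside L F i (λ j → g j + g (suc j)) i<L ⟩
  g i + g (suc i) ∎
  where
  open ≡-Reasoning
  inner : ℕ
  inner = sumBelow L (λ j → ind (F + j) (F + i) * (g j + g (suc j)))

Aℕ-freshPath-outside : ∀ y F L b g x → x < F ⊎ F + L ≤ x →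
  Aℕ (freshPath y F L b) g x ≡ ind y x * g 0 + ind b x * g L
Aℕ-freshPath-outside y F L b g x outside =
  trans (Aℕ-freshPath y F L b g x)
    (trans (cong (ind y x * g 0 + ind b x * g L +_) (sumBelow-ind-outside L F x (λ i → g i + g (suc i)) outside))
           (+-identityʳ _))

Bounded-freshPath : ∀ {B} y F L b → y < B → b < B → F + L ≤ B → Bounded B (freshPath y F L b)
Bounded-freshPath y F zero    b y<B b<B _     = (y<B , b<B) ∷ []
Bounded-freshPath {B} y F (suc L) b y<B b<B F+L≤B =
  (y<B , F<B) ∷ Bounded-freshPath F (suc F) L b F<B b<B (subst (_≤ B) (+-suc F L) F+L≤B)
  where
  F<B : F < B
  F<B = <-≤-trans (m<m+n F z<s) F+L≤B

Aℕ-freshPath-++ : ∀ y F L b E g x →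
  Aℕ (freshPath y F L b ++ E) g x ≡ Aℕ (freshPath y F L b) g x + Aℕ E (g ∘ (suc L +_)) x
Aℕ-freshPath-++ y F L b E g x =
  trans (Aℕ-++ (freshPath y F L b) E g x)
    (cong (λ l → Aℕ (freshPath y F L b) g x + Aℕ E (g ∘ (l +_)) x) (length-freshPath y F L b))

subdivide : ℕ → ℕ → Graph → Graph
subdivide K N []            = []
subdivide K N ((a , b) ∷ E) = freshPath a N K b ++ subdivide K (N + K) E

length-subdivide : ∀ K N E → length (subdivide K N E) ≡ length E * suc K
length-subdivide K N []            = refl
length-subdivide K N ((a , b) ∷ E) =
  trans (length-++ (freshPath a N K b))
        (cong₂ _+_ (length-freshPath a N K b) (length-subdivide K (N + K) E))

foldl-subdivEdge : ∀ K N acc E →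
  foldl (subdivEdge (suc K)) (N , acc) E ≡ (N + length E * K , acc ++ subdivide K N E)
foldl-subdivEdge K N acc []            = cong₂ _,_ (sym (+-identityʳ N)) (sym (++-identityʳ acc))
foldl-subdivEdge K N acc ((a , b) ∷ E) = begin
  foldl (subdivEdge (suc K)) (N + K , acc ++ pathE (a ∷ fresh N K ++ [ b ])) E
    ≡⟨ cong (λ p → foldl (subdivEdge (suc K)) (N + K , acc ++ pathE (a ∷ p ++ [ b ])) E)
            (fresh≡range N K) ⟩
  foldl (subdivEdge (suc K)) (N + K , acc ++ freshPath a N K b) E
    ≡⟨ foldl-subdivEdge K (N + K) (acc ++ freshPath a N K b) E ⟩
  (N + K + length E * K , (acc ++ freshPath a N K b) ++ subdivide K (N + K) E)
    ≡⟨ cong₂ _,_ (+-assoc N K (length E * K))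
                 (++-assoc acc (freshPath a N K b) (subdivide K (N + K) E)) ⟩
  (N + length ((a , b) ∷ E) * K , acc ++ subdivide K N ((a , b) ∷ E)) ∎
  where open ≡-Reasoning

S≡subdivide : ∀ K N E → proj₂ (S (suc K) (N , E)) ≡ subdivide K N E
S≡subdivide K N E = cong proj₂ (foldl-subdivEdge K N [] E)

Aℕ-subdivide-away : ∀ K {B} F E g x → Bounded B E → B ≤ x → x < F → Aℕ (subdivide K F E) g x ≡ 0
Aℕ-subdivide-away K F []            g x []                      B≤x x<F = refl
Aℕ-subdivide-away K F ((a , b) ∷ E) g x ((a<B , b<B) ∷ bounded) B≤x x<F = begin
  Aℕ (freshPath a F K b ++ subdivide K (F + K) E) g x
    ≡⟨ Aℕ-freshPath-++ a F K b (subdivide K (F + K) E) g x ⟩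
  Aℕ (freshPath a F K b) g x + Aℕ (subdivide K (F + K) E) (g ∘ (suc K +_)) x
    ≡⟨ cong₂ _+_ (Aℕ-freshPath-outside a F K b g x (inj₁ x<F))
         (Aℕ-subdivide-away K (F + K) E (g ∘ (suc K +_)) x bounded B≤x (<-≤-trans x<F (m≤m+n F K))) ⟩
  ind a x * g 0 + ind b x * g K + 0
    ≡⟨ cong₂ (λ p q → p * g 0 + q * g K + 0)
             (ind-< (<-≤-trans a<B B≤x)) (ind-< (<-≤-trans b<B B≤x)) ⟩
  0 ∎
  where open ≡-Reasoning

meets-subdivide-fresh : ∀ K N E j i → Bounded N E → j < length E → i < K →
  Meets (subdivide K N E) (N + (j * K + i)) (j * suc K + i ∷ j * suc K + suc i ∷ [])
meets-subdivide-fresh K N ((a , b) ∷ E) zero i ((a<N , b<N) ∷ bounded) _ i<K = meets λ g → begin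
  Aℕ (freshPath a N K b ++ subdivide K (N + K) E) g (N + i)
    ≡⟨ Aℕ-freshPath-++ a N K b (subdivide K (N + K) E) g (N + i) ⟩
  Aℕ (freshPath a N K b) g (N + i) + Aℕ (subdivide K (N + K) E) (g ∘ (suc K +_)) (N + i)
    ≡⟨ cong₂ _+_ (Aℕ-freshPath-inside a N K b g i a<N b<N i<K)
         (Aℕ-subdivide-away K (N + K) E (g ∘ (suc K +_)) (N + i) bounded (m≤m+n N i) (+-monoʳ-< N i<K)) ⟩
  g i + g (suc i) + 0
    ≡⟨ +-assoc (g i) (g (suc i)) 0 ⟩
  g i + (g (suc i) + 0) ∎
  where open ≡-Reasoning
meets-subdivide-fresh K N ((a , b) ∷ E) (suc j) i ((a<N , b<N) ∷ bounded) (s<s j<) i<K = meets Aℕ≡sum′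
  where
  open ≡-Reasoning
  x : ℕ
  x = N + (suc j * K + i)
  x≡ : x ≡ N + K + (j * K + i)
  x≡ = trans (cong (N +_) (+-assoc K (j * K) i)) (sym (+-assoc N K (j * K + i)))
  N≤x : N ≤ x
  N≤x = m≤m+n N (suc j * K + i)
  N+K≤x : N + K ≤ x
  N+K≤x = subst (N + K ≤_) (sym x≡) (m≤m+n (N + K) (j * K + i))
  bounded′ : Bounded (N + K) E
  bounded′ = All.map (λ (a<N , b<N) → ≤-trans a<N (m≤m+n N K) , ≤-trans b<N (m≤m+n N K)) bounded
  Aℕ≡sum′ : ∀ g → Aℕ (freshPath a N K b ++ subdivide K (N + K) E) g x ≡
                  g (suc j * suc K + i) + (g (suc j * suc K + suc i) + 0)
  Aℕ≡sum′ g = begin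
    Aℕ (freshPath a N K b ++ subdivide K (N + K) E) g x
      ≡⟨ Aℕ-freshPath-++ a N K b (subdivide K (N + K) E) g x ⟩
    Aℕ (freshPath a N K b) g x + tail x
      ≡⟨ cong₂ _+_ (Aℕ-freshPath-outside a N K b g x (inj₂ N+K≤x)) (cong tail x≡) ⟩
    ind a x * g 0 + ind b x * g K + tail (N + K + (j * K + i))
      ≡⟨ cong₂ (λ p q → p * g 0 + q * g K + tail (N + K + (j * K + i)))
               (ind-< (<-≤-trans a<N N≤x)) (ind-< (<-≤-trans b<N N≤x)) ⟩
    tail (N + K + (j * K + i))
      ≡⟨ Aℕ≡sum (meets-subdivide-fresh K (N + K) E j i bounded′ j< i<K) (g ∘ (suc K +_)) ⟩
    g (suc K + (j * suc K + i)) + (g (suc K + (j * suc K + suc i)) + 0)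
      ≡⟨ cong₂ (λ p q → g p + (g q + 0)) (sym (+-assoc (suc K) _ i)) (sym (+-assoc (suc K) _ (suc i))) ⟩
    g (suc j * suc K + i) + (g (suc j * suc K + suc i) + 0) ∎
    where
    tail : ℕ → ℕ
    tail = Aℕ (subdivide K (N + K) E) (g ∘ (suc K +_))

Aℕ-subdivide-original : ∀ K N E g x → x < N →
  (∀ j → j < length E → g (j * suc K) ≡ g (j * suc K + K)) →
  Aℕ (subdivide K N E) g x ≡ Aℕ E (λ j → g (j * suc K)) x
Aℕ-subdivide-original K N []            g x x<N ends-agree = refl
Aℕ-subdivide-original K N ((a , b) ∷ E) g x x<N ends-agree = begin
  Aℕ (freshPath a N K b ++ subdivide K (N + K) E) g x
    ≡⟨ Aℕ-freshPath-++ a N K b (subdivide K (N + K) E) g x ⟩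
  Aℕ (freshPath a N K b) g x + Aℕ (subdivide K (N + K) E) (g ∘ (suc K +_)) x
    ≡⟨ cong₂ _+_ (Aℕ-freshPath-outside a N K b g x (inj₁ x<N))
         (Aℕ-subdivide-original K (N + K) E (g ∘ (suc K +_)) x (<-≤-trans x<N (m≤m+n N K))
                                tail-ends-agree) ⟩
  ind a x * g 0 + ind b x * g K + rest
    ≡⟨ cong (λ v → ind a x * g 0 + ind b x * v + rest) (sym (ends-agree 0 z<s)) ⟩
  ind a x * g 0 + ind b x * g 0 + rest
    ≡⟨ cong (_+ rest) (sym (trans (*-comm (g 0) _) (*-distribʳ-+ (g 0) (ind a x) (ind b x)))) ⟩
  g 0 * (ind a x + ind b x) + rest ∎
  where
  open ≡-Reasoning
  rest : ℕ
  rest = Aℕ E (λ j → g (suc K + j * suc K)) x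
  tail-ends-agree : ∀ j → j < length E → g (suc K + j * suc K) ≡ g (suc K + (j * suc K + K))
  tail-ends-agree j j< = trans (ends-agree (suc j) (s<s j<)) (cong g (+-assoc (suc K) (j * suc K) K))

Balanced-from-subdivide : ∀ K N E U G → Bounded N E →
  (∀ j → j < length E → U (j * suc K) ≡ U (j * suc K + K)) →
  (∀ j → j < length E → G (j * suc K) ≡ G (j * suc K + K)) →
  Balanced (subdivide K N E) U G → Balanced E (λ j → U (j * suc K)) (λ j → G (j * suc K))
Balanced-from-subdivide K N E U G bounded U-ends G-ends balanced x with x <? N
... | yes x<N = begin
  Aℕ E (λ j → mark U G (j * suc K)) x
    ≡⟨ sym (Aℕ-subdivide-original K N E (mark U G) x x<N (marks-agree U U-ends)) ⟩
  Aℕ (subdivide K N E) (mark U G) x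
    ≡⟨ balanced x ⟩
  Aℕ (subdivide K N E) (mark (not ∘ U) G) x
    ≡⟨ Aℕ-subdivide-original K N E (mark (not ∘ U) G) x x<N
         (marks-agree (not ∘ U) (λ j j<E → cong not (U-ends j j<E))) ⟩
  Aℕ E (λ j → mark (not ∘ U) G (j * suc K)) x ∎
  where
  open ≡-Reasoning
  marks-agree : ∀ V → (∀ j → j < length E → V (j * suc K) ≡ V (j * suc K + K)) →
    ∀ j → j < length E → mark V G (j * suc K) ≡ mark V G (j * suc K + K)
  marks-agree V V-ends j j<E = cong₂ (λ c s → ⟦ c ∧ s ⟧) (V-ends j j<E) (G-ends j j<E)
... | no x≮N = trans (Aℕ-beyond _ x bounded (≮⇒≥ x≮N)) (sym (Aℕ-beyond _ x bounded (≮⇒≥ x≮N)))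

subdivide-rigid : ∀ K q N E → K ≡ q * 2 → Bounded N E → Rigid E → Rigid (subdivide K N E)
subdivide-rigid K q N E K-even bounded rigid U F balancedU balancedF j′ j′< = begin
  F j′                ≡⟨ cong F (trans (m≡m%n+[m/n]*n j′ k) (+-comm (j′ % k) (j * k))) ⟩
  F (j * k + j′ % k)  ≡⟨ F-along j j<E (j′ % k) (≤-pred (m%n<n j′ k)) ⟩
  F (j * k)           ≡⟨ rigid (λ j → U (j * k)) (λ j → F (j * k))
                           (Balanced-from-subdivide K N E U (const true) bounded U-ends (λ _ _ → refl) balancedU)
                           (Balanced-from-subdivide K N E U F bounded U-ends F-ends balancedF) j j<E ⟩
  F 0                 ∎
  where
  open ≡-Reasoning
  k : ℕ
  k = suc K
  j : ℕ
  j = j′ / k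
  j<E : j < length E
  j<E = m<n*o⇒m/o<n (subst (j′ <_) (length-subdivide K N E) j′<)
  step : ∀ j i → j < length E → i < K →
    U (j * k + suc i) ≡ not (U (j * k + i)) × F (j * k + i) ≡ F (j * k + suc i)
  step j i j<E i<K = balanced-degree-two balancedU balancedF (meets-subdivide-fresh K N E j i bounded j<E i<K)
  U-ends : ∀ j → j < length E → U (j * k) ≡ U (j * k + K)
  U-ends j j<E = sym (alternating-chain U (j * k) K (λ i i<K → proj₁ (step j i j<E i<K)) q K-even)
  F-along : ∀ j → j < length E → ∀ i → i ≤ K → F (j * k + i) ≡ F (j * k)
  F-along j j<E = constant-chain F (j * k) K (λ i i<K → proj₂ (step j i j<E i<K))
  F-ends : ∀ j → j < length E → F (j * k) ≡ F (j * k + K)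
  F-ends j j<E = sym (F-along j j<E K ≤-refl)

Loopless : Graph → Set
Loopless E = All (λ e → proj₁ e ≢ proj₂ e) E

Loopless-freshPath : ∀ L .{{_ : NonZero L}} y F b → y < F → b < F → Loopless (freshPath y F L b)
Loopless-freshPath 1             y F b y<F b<F = <⇒≢ y<F ∷ >⇒≢ b<F ∷ []
Loopless-freshPath (suc (suc L)) y F b y<F b<F =
  <⇒≢ y<F ∷ Loopless-freshPath (suc L) F (suc F) b (n<1+n F) (m<n⇒m<1+n b<F)

deg-∷ : ∀ a b E x → deg ((a , b) ∷ E) x ≡ (if (a ≡ᵇ x) ∨ (b ≡ᵇ x) then 1 else 0) + deg E x
deg-∷ a b E x with (a ≡ᵇ x) ∨ (b ≡ᵇ x)
... | true  = refl
... | false = refl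

filter-weight≡incid : ∀ a b x → a ≢ b →
  (if (a ≡ᵇ x) ∨ (b ≡ᵇ x) then 1 else 0) ≡ (if a ≡ᵇ x then 1 else 0) + (if b ≡ᵇ x then 1 else 0)
filter-weight≡incid a b x a≢b with a ≡ᵇ x in a≡ᵇx | b ≡ᵇ x in b≡ᵇx
... | true  | true  = ⊥-elim (a≢b (trans (≡ᵇ⇒≡ a x (subst T (sym a≡ᵇx) _))
                                         (sym (≡ᵇ⇒≡ b x (subst T (sym b≡ᵇx) _)))))
... | true  | false = refl
... | false | true  = refl
... | false | false = refl

deg≡Aℕ : ∀ E x → Loopless E → deg E x ≡ Aℕ E (const 1) x
deg≡Aℕ []            x []               = refl
deg≡Aℕ ((a , b) ∷ E) x (a≢b ∷ loopless) = begin
  deg ((a , b) ∷ E) x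
    ≡⟨ deg-∷ a b E x ⟩
  (if (a ≡ᵇ x) ∨ (b ≡ᵇ x) then 1 else 0) + deg E x
    ≡⟨ cong₂ _+_ (trans (filter-weight≡incid a b x a≢b) (sym (+-identityʳ (incid (a , b) x))))
                 (deg≡Aℕ E x loopless) ⟩
  1 * incid (a , b) x + Aℕ E (const 1) x ∎
  where open ≡-Reasoning

deg-Meets : ∀ {E x js} → Loopless E → Meets E x js → deg E x ≡ length js
deg-Meets {E} {x} {js} loopless meets-x =
  trans (deg≡Aℕ E x loopless) (trans (Aℕ≡sum meets-x (const 1)) (sum-ones js))
  where
  sum-ones : ∀ ks → sum (map (const 1) ks) ≡ length ks
  sum-ones []       = refl
  sum-ones (_ ∷ ks) = cong suc (sum-ones ks)

-- The graphs G_r^n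

-- G_r^n for n = suc L: cycle c is attached at vertex attachment c, owns the fresh vertices
-- firstFresh c, …, firstFresh c + L - 1, and has the edges c * n, …, c * n + L of cycles C.
-- Thus the cycle attached at a vertex x > 0 is cycle suc x, and vertex 0 carries cycles 0 and 1.
module CycleTree (L : ℕ) {{_ : NonZero L}} where

  n : ℕ
  n = suc L

  attachment : ℕ → ℕ
  attachment zero    = zero
  attachment (suc c) = c

  firstFresh : ℕ → ℕ
  firstFresh c = suc (c * L)

  cycle : ℕ → Graph
  cycle c = freshPath (attachment c) (firstFresh c) L (attachment c)

  cyclesFrom : ℕ → ℕ → Graph
  cyclesFrom a zero    = []
  cyclesFrom a (suc l) = cycle a ++ cyclesFrom (suc a) l

  cycles : ℕ → Graph
  cycles = cyclesFrom 0

  ends : (ℕ → ℕ) → ℕ → ℕ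
  ends γ c = γ (c * n) + γ (c * n + L)

  firstFresh-suc : ∀ c → firstFresh c + L ≡ firstFresh (suc c)
  firstFresh-suc c = cong suc (+-comm (c * L) L)

  firstFresh-mono : ∀ {c c′} → c < c′ → firstFresh c + L ≤ firstFresh c′
  firstFresh-mono {c} {c′} c<c′ =
    subst (_≤ firstFresh c′) (sym (firstFresh-suc c)) (s≤s (*-monoˡ-≤ L c<c′))

  attachment<firstFresh : ∀ c → attachment c < firstFresh c
  attachment<firstFresh zero    = z<s
  attachment<firstFresh (suc c) = s≤s (≤-trans (m≤m*n c L) (m≤n+m (c * L) L))

  length-cyclesFrom : ∀ a l → length (cyclesFrom a l) ≡ l * n
  length-cyclesFrom a zero    = refl
  length-cyclesFrom a (suc l) =
    trans (length-++ (cycle a)) (cong₂ _+_ (length-freshPath _ _ L _) (length-cyclesFrom (suc a) l))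

  Aℕ-cyclesFrom : ∀ a l γ x →
    Aℕ (cyclesFrom a l) γ x ≡ sumBelow l (λ c → Aℕ (cycle (a + c)) (γ ∘ (c * n +_)) x)
  Aℕ-cyclesFrom a zero    γ x = refl
  Aℕ-cyclesFrom a (suc l) γ x = begin
    Aℕ (cycle a ++ cyclesFrom (suc a) l) γ x
      ≡⟨ Aℕ-freshPath-++ (attachment a) (firstFresh a) L (attachment a) (cyclesFrom (suc a) l) γ x ⟩
    Aℕ (cycle a) γ x + Aℕ (cyclesFrom (suc a) l) (γ ∘ (n +_)) x
      ≡⟨ cong₂ _+_ (cong (λ a′ → Aℕ (cycle a′) γ x) (sym (+-identityʳ a)))
                   (Aℕ-cyclesFrom (suc a) l (γ ∘ (n +_)) x) ⟩
    Aℕ (cycle (a + 0)) γ x + sumBelow l (λ c → Aℕ (cycle (suc a + c)) (γ ∘ (n +_) ∘ (c * n +_)) x)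
      ≡⟨ cong (Aℕ (cycle (a + 0)) γ x +_) (sumBelow-cong l (λ c →
           trans (cong (λ a′ → Aℕ (cycle a′) (γ ∘ (n +_) ∘ (c * n +_)) x) (sym (+-suc a c)))
                 (Aℕ-cong (cycle (a + suc c)) x (λ h → cong γ (sym (+-assoc n (c * n) h)))))) ⟩
    sumBelow (suc l) (λ c → Aℕ (cycle (a + c)) (γ ∘ (c * n +_)) x) ∎
    where open ≡-Reasoning

  child : ℕ → ℕ → ℕ
  child c i = suc (firstFresh c + i)

  ownTerms : (ℕ → ℕ) → ℕ → ℕ → ℕ
  ownTerms γ x c = sumBelow L (λ i → ind (firstFresh c + i) x * (γ (c * n + i) + γ (c * n + suc i)))

  attachedEnds freshTerms : ℕ → (ℕ → ℕ) → ℕ → ℕ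
  attachedEnds C γ x = sumBelow C (λ c → ind (attachment c) x * ends γ c)
  freshTerms   C γ x = sumBelow C (ownTerms γ x)

  Aℕ-cycles : ∀ C γ x → Aℕ (cycles C) γ x ≡ attachedEnds C γ x + freshTerms C γ x
  Aℕ-cycles C γ x = begin
    Aℕ (cycles C) γ x
      ≡⟨ Aℕ-cyclesFrom 0 C γ x ⟩
    sumBelow C (λ c → Aℕ (cycle c) (γ ∘ (c * n +_)) x)
      ≡⟨ sumBelow-cong C Aℕ-cycle ⟩
    sumBelow C (λ c → ind (attachment c) x * ends γ c + ownTerms γ x c)
      ≡⟨ sumBelow-+ C (λ c → ind (attachment c) x * ends γ c) (ownTerms γ x) ⟩
    attachedEnds C γ x + freshTerms C γ x ∎
    where
    open ≡-Reasoning
    Aℕ-cycle : ∀ c → Aℕ (cycle c) (γ ∘ (c * n +_)) x ≡ ind (attachment c) x * ends γ c + ownTerms γ x c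
    Aℕ-cycle c = begin
      Aℕ (cycle c) (γ ∘ (c * n +_)) x
        ≡⟨ Aℕ-freshPath d (firstFresh c) L d (γ ∘ (c * n +_)) x ⟩
      ind d x * γ (c * n + 0) + ind d x * γ (c * n + L) + ownTerms γ x c
        ≡⟨ cong (λ m → ind d x * γ m + ind d x * γ (c * n + L) + ownTerms γ x c) (+-identityʳ (c * n)) ⟩
      ind d x * γ (c * n) + ind d x * γ (c * n + L) + ownTerms γ x c
        ≡⟨ cong (_+ ownTerms γ x c) (sym (*-distribˡ-+ (ind d x) (γ (c * n)) (γ (c * n + L)))) ⟩
      ind d x * ends γ c + ownTerms γ x c ∎
      where
      d : ℕ
      d = attachment c

  freshTerms-root : ∀ C γ → freshTerms C γ 0 ≡ 0
  freshTerms-root C γ = sumBelow-zero C (ownTerms γ 0)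
    (λ c _ → sumBelow-ind-outside L (firstFresh c) 0 (λ i → γ (c * n + i) + γ (c * n + suc i)) (inj₁ z<s))

  freshTerms-fresh : ∀ C γ c i → c < C → i < L →
    freshTerms C γ (firstFresh c + i) ≡ γ (c * n + i) + γ (c * n + suc i)
  freshTerms-fresh C γ c i c<C i<L = begin
    freshTerms C γ x
      ≡⟨ sumBelow-single C (ownTerms γ x) c c<C (λ c′ _ c′≢c → sumBelow-ind-outside L (firstFresh c′) x
           (λ i → γ (c′ * n + i) + γ (c′ * n + suc i)) (outside c′ c′≢c)) ⟩
    ownTerms γ x c
      ≡⟨ sumBelow-ind-inside L (firstFresh c) i (λ j → γ (c * n + j) + γ (c * n + suc j)) i<L ⟩
    γ (c * n + i) + γ (c * n + suc i) ∎
    where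
    open ≡-Reasoning
    x : ℕ
    x = firstFresh c + i
    outside : ∀ c′ → c′ ≢ c → x < firstFresh c′ ⊎ firstFresh c′ + L ≤ x
    outside c′ c′≢c with <-cmp c′ c
    ... | tri≈ _ c′≡c _ = ⊥-elim (c′≢c c′≡c)
    ... | tri< c′<c _ _ = inj₂ (≤-trans (firstFresh-mono c′<c) (m≤m+n (firstFresh c) i))
    ... | tri> _ _ c<c′ = inj₁ (<-≤-trans (+-monoʳ-< (firstFresh c) i<L) (firstFresh-mono c<c′))

  attachedEnds-root : ∀ C γ → 2 ≤ C → attachedEnds C γ 0 ≡ ends γ 0 + ends γ 1
  attachedEnds-root (suc (suc C)) γ (s≤s (s≤s z≤n)) = begin
    ends γ 0 + 0 + (ends γ 1 + 0 + sumBelow C (λ _ → 0))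
      ≡⟨ cong (λ s → ends γ 0 + 0 + (ends γ 1 + 0 + s)) (sumBelow-zero C (λ _ → 0) (λ _ _ → refl)) ⟩
    ends γ 0 + 0 + (ends γ 1 + 0 + 0)
      ≡⟨ drop-zeros (ends γ 0) (ends γ 1) ⟩
    ends γ 0 + ends γ 1 ∎
    where
    open ≡-Reasoning
    drop-zeros : ∀ a b → a + 0 + (b + 0 + 0) ≡ a + b
    drop-zeros = solve-∀

  attachedEnds-root-alone : ∀ γ → attachedEnds 1 γ 0 ≡ ends γ 0
  attachedEnds-root-alone γ = trans (+-identityʳ _) (+-identityʳ _)

  attachedEnds-child : ∀ C γ x → suc (suc x) < C → attachedEnds C γ (suc x) ≡ ends γ (suc (suc x))
  attachedEnds-child (suc C) γ x (s<s sx<C) = sumBelow-ind-inside C 0 (suc x) (ends γ ∘ suc) sx<C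

  attachedEnds-none : ∀ C γ x → C ≤ suc (suc x) → attachedEnds C γ (suc x) ≡ 0
  attachedEnds-none zero    γ x _         = refl
  attachedEnds-none (suc C) γ x (s≤s C≤) = sumBelow-ind-outside C 0 (suc x) (ends γ ∘ suc) (inj₂ C≤)

  meets-root : ∀ C → 2 ≤ C → Meets (cycles C) 0 (0 ∷ L ∷ 1 * n ∷ 1 * n + L ∷ [])
  meets-root C 2≤C = meets λ γ → begin
    Aℕ (cycles C) γ 0
      ≡⟨ Aℕ-cycles C γ 0 ⟩
    attachedEnds C γ 0 + freshTerms C γ 0
      ≡⟨ cong₂ _+_ (attachedEnds-root C γ 2≤C) (freshTerms-root C γ) ⟩
    ends γ 0 + ends γ 1 + 0
      ≡⟨ reassociate (γ 0) (γ L) (γ (1 * n)) (γ (1 * n + L)) ⟩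
    γ 0 + (γ L + (γ (1 * n) + (γ (1 * n + L) + 0))) ∎
    where
    open ≡-Reasoning
    reassociate : ∀ a b c d → a + b + (c + d) + 0 ≡ a + (b + (c + (d + 0)))
    reassociate = solve-∀

  meets-root-alone : Meets (cycles 1) 0 (0 ∷ L ∷ [])
  meets-root-alone = meets λ γ → begin
    Aℕ (cycles 1) γ 0
      ≡⟨ Aℕ-cycles 1 γ 0 ⟩
    attachedEnds 1 γ 0 + freshTerms 1 γ 0
      ≡⟨ cong₂ _+_ (attachedEnds-root-alone γ) (freshTerms-root 1 γ) ⟩
    γ 0 + γ L + 0
      ≡⟨ +-assoc (γ 0) (γ L) 0 ⟩
    γ 0 + (γ L + 0) ∎
    where open ≡-Reasoning

  meets-inner : ∀ C c i → c < C → i < L → child c i < C →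
    Meets (cycles C) (firstFresh c + i) (c * n + i ∷ c * n + suc i ∷ child c i * n ∷ child c i * n + L ∷ [])
  meets-inner C c i c<C i<L child<C = meets λ γ → begin
    Aℕ (cycles C) γ x
      ≡⟨ Aℕ-cycles C γ x ⟩
    attachedEnds C γ x + freshTerms C γ x
      ≡⟨ cong₂ _+_ (attachedEnds-child C γ (c * L + i) child<C) (freshTerms-fresh C γ c i c<C i<L) ⟩
    ends γ (suc x) + (γ (c * n + i) + γ (c * n + suc i))
      ≡⟨ reassociate (γ (c * n + i)) (γ (c * n + suc i)) (γ (suc x * n)) (γ (suc x * n + L)) ⟩
    γ (c * n + i) + (γ (c * n + suc i) + (γ (suc x * n) + (γ (suc x * n + L) + 0))) ∎
    where
    open ≡-Reasoning
    x : ℕ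
    x = firstFresh c + i
    reassociate : ∀ a b c d → c + d + (a + b) ≡ a + (b + (c + (d + 0)))
    reassociate = solve-∀

  meets-leaf : ∀ C c i → c < C → i < L → C ≤ child c i →
    Meets (cycles C) (firstFresh c + i) (c * n + i ∷ c * n + suc i ∷ [])
  meets-leaf C c i c<C i<L C≤child = meets λ γ → begin
    Aℕ (cycles C) γ x
      ≡⟨ Aℕ-cycles C γ x ⟩
    attachedEnds C γ x + freshTerms C γ x
      ≡⟨ cong₂ _+_ (attachedEnds-none C γ (c * L + i) C≤child) (freshTerms-fresh C γ c i c<C i<L) ⟩
    γ (c * n + i) + γ (c * n + suc i)
      ≡⟨ cong (γ (c * n + i) +_) (sym (+-identityʳ _)) ⟩
    γ (c * n + i) + (γ (c * n + suc i) + 0) ∎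
    where
    open ≡-Reasoning
    x : ℕ
    x = firstFresh c + i

  fresh-vertex : ∀ x → Σ ℕ λ p → Σ ℕ λ i → i < L × p ≤ x × firstFresh p + i ≡ suc x
  fresh-vertex x = x / L , x % L , m%n<n x L , m/n≤m x L ,
    cong suc (sym (trans (m≡m%n+[m/n]*n x L) (+-comm (x % L) (x / L * L))))

  firstFresh-cancel-< : ∀ {p i C} → firstFresh p + i < firstFresh C → p < C
  firstFresh-cancel-< {p} {i} lt =
    ≰⇒> (λ C≤p → <⇒≱ lt (≤-trans (s≤s (*-monoˡ-≤ L C≤p)) (m≤m+n (firstFresh p) i)))

  ≤firstFresh-suc : ∀ c → c ≤ firstFresh (suc c)
  ≤firstFresh-suc c = ≤-trans (m≤m*n c L) (≤-trans (m≤n+m (c * L) L) (n≤1+n _))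

  Loopless-cycles : ∀ C → Loopless (cycles C)
  Loopless-cycles = go 0
    where
    go : ∀ a l → Loopless (cyclesFrom a l)
    go a zero    = []
    go a (suc l) = ++⁺ (Loopless-freshPath L (attachment a) (firstFresh a) (attachment a)
                          (attachment<firstFresh a) (attachment<firstFresh a)) (go (suc a) l)

  Bounded-cycles : ∀ C → Bounded (firstFresh C) (cycles C)
  Bounded-cycles C = go 0 C ≤-refl
    where
    go : ∀ a l → a + l ≤ C → Bounded (firstFresh C) (cyclesFrom a l)
    go a zero    _     = []
    go a (suc l) a+l<C = ++⁺ (Bounded-freshPath _ _ L _ attachment<C attachment<C (firstFresh-mono a<C))
                             (go (suc a) l (subst (_≤ C) (+-suc a l) a+l<C))
      where
      a<C : a < C
      a<C = <-≤-trans (m<m+n a z<s) a+l<C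
      attachment<C : attachment a < firstFresh C
      attachment<C =
        <-≤-trans (attachment<firstFresh a) (≤-trans (m≤m+n (firstFresh a) L) (firstFresh-mono a<C))

  degree-inner : ∀ c x → x < c → deg (cycles (suc c)) x ≡ 4
  degree-inner c zero    0<c = deg-Meets (Loopless-cycles (suc c)) (meets-root (suc c) (s<s 0<c))
  degree-inner c (suc x) x<c with fresh-vertex x
  ... | p , i , i<L , p≤x , refl = deg-Meets (Loopless-cycles (suc c)) (meets-inner (suc c) p i p<C i<L (s<s x<c))
    where
    p<C : p < suc c
    p<C = ≤-<-trans p≤x (m<n⇒m<1+n (<-trans (n<1+n x) x<c))

  degree-leaf : ∀ c x → c ≤ x → x < firstFresh (suc c) → deg (cycles (suc c)) x ≡ 2
  degree-leaf zero    zero    _   _   = deg-Meets (Loopless-cycles 1) meets-root-alone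
  degree-leaf c       (suc x) c≤x x<N with fresh-vertex x
  ... | p , i , i<L , _ , refl =
    deg-Meets (Loopless-cycles (suc c)) (meets-leaf (suc c) p i (firstFresh-cancel-< x<N) i<L (s≤s c≤x))

  degree-two-vertices : ∀ c → filterᵇ (λ x → deg (cycles (suc c)) x ≡ᵇ 2) (upTo (firstFresh (suc c)))
                              ≡ range c (firstFresh (suc c) ∸ c)
  degree-two-vertices c = begin
    filterᵇ degree-two (upTo N)
      ≡⟨ cong (filterᵇ degree-two) (applyUpTo≡range N 0 (λ _ → refl)) ⟩
    filterᵇ degree-two (range 0 N)
      ≡⟨ cong (λ N′ → filterᵇ degree-two (range 0 N′)) (sym (m+[n∸m]≡n (≤firstFresh-suc c))) ⟩
    filterᵇ degree-two (range 0 (c + (N ∸ c)))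
      ≡⟨ cong (filterᵇ degree-two) (range-++ 0 c (N ∸ c)) ⟩
    filterᵇ degree-two (range 0 c ++ range c (N ∸ c))
      ≡⟨ filter-++ (T? ∘ degree-two) (range 0 c) (range c (N ∸ c)) ⟩
    filterᵇ degree-two (range 0 c) ++ filterᵇ degree-two (range c (N ∸ c))
      ≡⟨ cong₂ _++_ (filter-none (T? ∘ degree-two) (All-range 0 c inner-rejected))
                    (filter-all (T? ∘ degree-two) (All-range c (N ∸ c) leaf-accepted)) ⟩
    range c (N ∸ c) ∎
    where
    open ≡-Reasoning
    N : ℕ
    N = firstFresh (suc c)
    degree-two : ℕ → Bool
    degree-two x = deg (cycles (suc c)) x ≡ᵇ 2
    inner-rejected : ∀ x → x < c → ¬ T (degree-two (0 + x))
    inner-rejected x x<c = subst (λ d → ¬ T (d ≡ᵇ 2)) (sym (degree-inner c x x<c)) (λ ())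
    leaf-accepted : ∀ i → i < N ∸ c → T (degree-two (c + i))
    leaf-accepted i i< = subst (λ d → T (d ≡ᵇ 2)) (sym (degree-leaf c (c + i) (m≤m+n c i)
                           (subst (c + i <_) (m+[n∸m]≡n (≤firstFresh-suc c)) (+-monoʳ-< c i<)))) _

  cyclesFrom-suc : ∀ a l → cyclesFrom a (suc l) ≡ cyclesFrom a l ++ cycle (a + l)
  cyclesFrom-suc a zero    = trans (++-identityʳ (cycle a)) (cong cycle (sym (+-identityʳ a)))
  cyclesFrom-suc a (suc l) = begin
    cycle a ++ cyclesFrom (suc a) (suc l)
      ≡⟨ cong (cycle a ++_) (cyclesFrom-suc (suc a) l) ⟩
    cycle a ++ (cyclesFrom (suc a) l ++ cycle (suc a + l))
      ≡⟨ sym (++-assoc (cycle a) (cyclesFrom (suc a) l) (cycle (suc a + l))) ⟩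
    cyclesFrom a (suc l) ++ cycle (suc a + l)
      ≡⟨ cong (λ c → cyclesFrom a (suc l) ++ cycle c) (sym (+-suc a l)) ⟩
    cyclesFrom a (suc l) ++ cycle (a + suc l) ∎
    where open ≡-Reasoning

  attach-cycles : ∀ c D → foldl (attach n) (firstFresh (suc c) , cycles (suc c)) (range c D)
                         ≡ (firstFresh (suc c + D) , cycles (suc c + D))
  attach-cycles c zero    = cong (λ C → firstFresh C , cycles C) (sym (+-identityʳ (suc c)))
  attach-cycles c (suc D) = begin
    foldl (attach n) (attach n (firstFresh (suc c) , cycles (suc c)) c) (range (suc c) D)
      ≡⟨ cong (λ G′ → foldl (attach n) G′ (range (suc c) D)) attach-next ⟩
    foldl (attach n) (firstFresh (suc (suc c)) , cycles (suc (suc c))) (range (suc c) D)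
      ≡⟨ attach-cycles (suc c) D ⟩
    (firstFresh (suc (suc c) + D) , cycles (suc (suc c) + D))
      ≡⟨ cong (λ C → firstFresh C , cycles C) (sym (+-suc (suc c) D)) ⟩
    (firstFresh (suc c + suc D) , cycles (suc c + suc D)) ∎
    where
    open ≡-Reasoning
    attach-next : attach n (firstFresh (suc c) , cycles (suc c)) c
                ≡ (firstFresh (suc (suc c)) , cycles (suc (suc c)))
    attach-next = cong₂ _,_ (firstFresh-suc (suc c))
      (trans (cong (λ p → cycles (suc c) ++ pathE (c ∷ p ++ [ c ])) (fresh≡range (firstFresh (suc c)) L))
             (sym (cyclesFrom-suc 0 (suc c))))

  lastCycle : ℕ → ℕ
  lastCycle zero    = zero
  lastCycle (suc r) = firstFresh (suc (lastCycle r))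

  G≡cycles : ∀ r → G n r ≡ (firstFresh (suc (lastCycle r)) , cycles (suc (lastCycle r)))
  G≡cycles zero    = cong₂ _,_ (cong suc (sym (+-identityʳ L)))
    (trans (cong (λ p → pathE (0 ∷ p ++ [ 0 ])) (applyUpTo≡range L 1 (λ _ → refl)))
           (sym (++-identityʳ (cycle 0))))
  G≡cycles (suc r) = begin
    grow (G n r)
      ≡⟨ cong grow (G≡cycles r) ⟩
    foldl (attach n) (N , cycles (suc c)) (filterᵇ (λ x → deg (cycles (suc c)) x ≡ᵇ 2) (upTo N))
      ≡⟨ cong (foldl (attach n) (N , cycles (suc c))) (degree-two-vertices c) ⟩
    foldl (attach n) (N , cycles (suc c)) (range c (N ∸ c))
      ≡⟨ attach-cycles c (N ∸ c) ⟩
    (firstFresh (suc c + (N ∸ c)) , cycles (suc c + (N ∸ c)))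
      ≡⟨ cong (λ C → firstFresh (suc C) , cycles (suc C)) (m+[n∸m]≡n (≤firstFresh-suc c)) ⟩
    (firstFresh (suc N) , cycles (suc N)) ∎
    where
    open ≡-Reasoning
    c : ℕ
    c = lastCycle r
    N : ℕ
    N = firstFresh (suc c)
    grow : LGraph → LGraph
    grow (N′ , E) = foldl (attach n) (N′ , E) (filterᵇ (λ x → deg E x ≡ᵇ 2) (upTo N′))

  -- Cycle c is a leaf of the tree of cycles exactly when C′ ≤ c.
  module Rigidity (h C′ : ℕ) (L-even : L ≡ h * 2) (U F : ℕ → Bool)
    (balancedU : Balanced (cycles (2 + C′ * L)) U (const true))
    (balancedF : Balanced (cycles (2 + C′ * L)) U F) where

    C : ℕ
    C = 2 + C′ * L

    child-exists : ∀ c i → c < C′ → i < L → child c i < C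
    child-exists c i c<C′ i<L = s<s (s<s (begin-strict
      c * L + i   <⟨ +-monoʳ-< (c * L) i<L ⟩
      c * L + L   ≡⟨ +-comm (c * L) L ⟩
      suc c * L   ≤⟨ *-monoˡ-≤ L c<C′ ⟩
      C′ * L      ∎))
      where open ≤-Reasoning

    no-child : ∀ c i → C′ ≤ c → C ≤ child c i
    no-child c i C′≤c = s≤s (s≤s (≤-trans (*-monoˡ-≤ L C′≤c) (m≤m+n (c * L) i)))

    parent<child : ∀ c i → c < child c i
    parent<child c i = s≤s (≤-trans (m≤m*n c L) (≤-trans (m≤m+n (c * L) i) (n≤1+n _)))

    Uniform : ℕ → Set
    Uniform c = U (c * n) ≡ U (c * n + L) × (∀ i → i ≤ L → F (c * n + i) ≡ F (c * n))

    leaf-uniform : ∀ c → c < C → C′ ≤ c → Uniform c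
    leaf-uniform c c<C C′≤c =
      sym (alternating-chain U (c * n) L (proj₁ ∘₂ step) h L-even) ,
      constant-chain F (c * n) L (proj₂ ∘₂ step)
      where
      step : ∀ i → i < L → U (c * n + suc i) ≡ not (U (c * n + i)) × F (c * n + i) ≡ F (c * n + suc i)
      step i i<L = balanced-degree-two balancedU balancedF (meets-leaf C c i c<C i<L (no-child c i C′≤c))

    through-child : ∀ c i → c < C → i < L → child c i < C → Uniform (child c i) →
      U (c * n + i) ≡ U (c * n + suc i) ×
      F (c * n + i) ≡ F (child c i * n) × F (c * n + suc i) ≡ F (child c i * n)
    through-child c i c<C i<L child<C (U-ends , F-along) =
      balanced-degree-four balancedU balancedF (meets-inner C c i c<C i<L child<C) U-ends (sym (F-along L ≤-refl))

    inner-uniform : ∀ c → c < C → c < C′ → (∀ i → i < L → Uniform (child c i)) → Uniform c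
    inner-uniform c c<C c<C′ children-uniform =
      sym (constant-chain U (c * n) L (proj₁ ∘₂ step) L ≤-refl) ,
      constant-chain F (c * n) L (λ i i<L → let (_ , left , right) = step i i<L in trans left (sym right))
      where
      step : ∀ i → i < L → U (c * n + i) ≡ U (c * n + suc i) ×
                           F (c * n + i) ≡ F (child c i * n) × F (c * n + suc i) ≡ F (child c i * n)
      step i i<L = through-child c i c<C i<L (child-exists c i c<C′ i<L) (children-uniform i i<L)

    uniform : ∀ c → c < C → Uniform c
    uniform = downward-induction Uniform C leaf-or-inner
      where
      leaf-or-inner : ∀ c → c < C → (∀ c′ → c < c′ → c′ < C → Uniform c′) → Uniform c
      leaf-or-inner c c<C uniform-above with c <? C′
      ... | yes c<C′ = inner-uniform c c<C c<C′
                         (λ i i<L → uniform-above (child c i) (parent<child c i) (child-exists c i c<C′ i<L))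
      ... | no  c≮C′ = leaf-uniform c c<C (≮⇒≥ c≮C′)

    F-cycle-start : ∀ c → c < C → F (c * n) ≡ F 0
    F-cycle-start = <-rec (λ c → c < C → F (c * n) ≡ F 0) go
      where
      go : ∀ c → (∀ {c′} → c′ < c → c′ < C → F (c′ * n) ≡ F 0) → c < C → F (c * n) ≡ F 0
      go zero          _       _   = refl
      go (suc zero)    _       1<C = sym (proj₁ (proj₂ (balanced-degree-four balancedU balancedF
        (meets-root C (s≤s (s≤s z≤n))) (proj₁ (uniform 1 1<C)) (sym (proj₂ (uniform 1 1<C) L ≤-refl)))))
      go (suc (suc x)) earlier c<C with fresh-vertex x
      ... | p , i , i<L , p≤x , refl = begin
        F (child p i * n)   ≡⟨ sym (proj₁ (proj₂ (through-child p i p<C i<L c<C (uniform (child p i) c<C)))) ⟩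
        F (p * n + i)       ≡⟨ proj₂ (uniform p p<C) i (<⇒≤ i<L) ⟩
        F (p * n)           ≡⟨ earlier p<c p<C ⟩
        F 0                 ∎
        where
        open ≡-Reasoning
        p<c : p < child p i
        p<c = s≤s (≤-trans p≤x (n≤1+n _))
        p<C : p < C
        p<C = <-trans p<c c<C

    F-constant : ∀ j → j < length (cycles C) → F j ≡ F 0
    F-constant j j< = begin
      F j                       ≡⟨ cong F (trans (m≡m%n+[m/n]*n j n) (+-comm (j % n) (j / n * n))) ⟩
      F (j / n * n + j % n)     ≡⟨ proj₂ (uniform (j / n) c<C) (j % n) (≤-pred (m%n<n j n)) ⟩
      F (j / n * n)             ≡⟨ F-cycle-start (j / n) c<C ⟩
      F 0                       ∎
      where
      open ≡-Reasoning
      c<C : j / n < C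
      c<C = m<n*o⇒m/o<n (subst (j <_) (length-cyclesFrom 0 C) j<)

  cycles-rigid : ∀ h C′ → L ≡ h * 2 → Rigid (cycles (2 + C′ * L))
  cycles-rigid h C′ L-even U F balancedU balancedF = Rigidity.F-constant h C′ L-even U F balancedU balancedF

subdivided-cycle-tree-graver : ∀ h h′ r →
  let E = proj₂ (S (suc (h′ * 2)) (G (suc (suc h * 2)) (suc r))) in
  ∀ es → ClosedEulerianTrail E es → InGraver E (Bu E es) (Bv E es)
subdivided-cycle-tree-graver h h′ r es trail =
  eulerian-trail-graver E es (suc (C′ * suc h) * n * suc K) length-even (subst Rigid (sym E≡) rigid) trail
  where
  open CycleTree (suc h * 2)
  K : ℕ
  K = h′ * 2
  C′ : ℕ
  C′ = suc (lastCycle r)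
  C : ℕ
  C = 2 + C′ * (suc h * 2)
  E : Graph
  E = proj₂ (S (suc K) (G n (suc r)))
  E≡ : E ≡ subdivide K (firstFresh C) (cycles C)
  E≡ = trans (cong (proj₂ ∘ S (suc K)) (G≡cycles (suc r))) (S≡subdivide K (firstFresh C) (cycles C))
  rigid : Rigid (subdivide K (firstFresh C) (cycles C))
  rigid = subdivide-rigid K h′ (firstFresh C) (cycles C) refl (Bounded-cycles C) (cycles-rigid (suc h) C′ refl)
  length-even : length E ≡ suc (C′ * suc h) * n * suc K * 2
  length-even = begin
    length E                                        ≡⟨ cong length E≡ ⟩
    length (subdivide K (firstFresh C) (cycles C))  ≡⟨ length-subdivide K (firstFresh C) (cycles C) ⟩
    length (cycles C) * suc K                       ≡⟨ cong (_* suc K) (length-cyclesFrom 0 C) ⟩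
    C * n * suc K                                   ≡⟨ halve C′ (suc h) n (suc K) ⟩
    suc (C′ * suc h) * n * suc K * 2                ∎
    where
    open ≡-Reasoning
    halve : ∀ c h n k → (2 + c * (h * 2)) * n * k ≡ (1 + c * h) * n * k * 2
    halve = solve-∀

odd-form : ∀ m → m % 2 ≡ 1 → m ≡ suc (m / 2 * 2)
odd-form m m-odd = trans (m≡m%n+[m/n]*n m 2) (cong (_+ m / 2 * 2) m-odd)

proposition3p8 : (n k r : ℕ) → 3 ≤ n → n % 2 ≡ 1 → 3 ≤ k → k % 2 ≡ 1 → 1 ≤ r →
    (es : List (Fin (length (proj₂ (S k (G n r)))))) →
    ClosedEulerianTrail (proj₂ (S k (G n r))) es →
    InGraver (proj₂ (S k (G n r))) (Bu (proj₂ (S k (G n r))) es) (Bv (proj₂ (S k (G n r))) es)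
proposition3p8 n k (suc r) 3≤n n-odd _ k-odd _ with n / 2 | odd-form n n-odd | k / 2 | odd-form k k-odd
... | zero  | refl | _  | _    = ⊥-elim (≤⇒≯ 3≤n (s≤s (s≤s z≤n)))
... | suc h | refl | h′ | refl = subdivided-cycle-tree-graver h h′ r
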